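{- Let $A$ be an $m \times n$ $0,1$-matrix with non-increasing row sums $(r_1,\dots,r_m)$ and non-increasing column sums $(c_1,\dots,c_n)$, and let $F$ be its Ferrers matrix, i.e. the $m\times n$ $0,1$-matrix whose $i$-th row consists of $r_i$ ones followed by $n-r_i$ zeros. Then the minimum number of shifts needed to transform $A$ into $F$ equals $$disc(A)=\sum_{j=1}^{n}(F_j-A_j),$$ where for the $j$-th columns $F_j$ and $A_j$ we write $(F_j-A_j):=\sum_{i=1}^m (F_{i,j}-A_{i,j})^+$.
   Context: A shift in a $0,1$-matrix is the movement of a $1$ in some row from a column to a column further to the left in the same row that contains a $0$ in that row (so the entry at the old position becomes $0$ and the entry at the new position becomes $1$). The discrepancy $disc(A)$ is the minimum number of shifts needed to transform $A$ into its Ferrers matrix $F$. For two $m\times n$ $0,1$-matrices $V,U$ and a column index $j$, $(V_j-U_j):=\sum_{i=1}^m (V_{i,j}-U_{i,j})^+$, where $x^+=\max(x,0)$. -}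

module Defs where

open import Data.Nat using (ℕ; zero; suc; _+_; _∸_; _<_; _≤_; _≥_)
open import Data.Nat using (_<ᵇ_)
open import Data.Fin using (Fin; toℕ; _≟_)
open import Data.Bool using (Bool; true; false; if_then_else_)
open import Relation.Nullary using (does)
open import Relation.Binary.PropositionalEquality using (_≡_)

-- an m × n 0,1-matrix (true = 1, false = 0); indices are 0-based
Matrix : ℕ → ℕ → Set
Matrix m n = Fin m → Fin n → Bool

bit : Bool → ℕ
bit true  = 1
bit false = 0

sumFin : ∀ {n} → (Fin n → ℕ) → ℕ
sumFin {zero}  f = 0
sumFin {suc n} f = f Fin.zero + sumFin (λ k → f (Fin.suc k))

rowSum : ∀ {m n} → Matrix m n → Fin m → ℕ
rowSum A i = sumFin (λ j → bit (A i j))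

colSum : ∀ {m n} → Matrix m n → Fin n → ℕ
colSum A j = sumFin (λ i → bit (A i j))

NonIncreasing : ∀ {k} → (Fin k → ℕ) → Set
NonIncreasing {k} s = ∀ (a b : Fin k) → toℕ a ≤ toℕ b → s a ≥ s b

ferrers : ∀ {m n} → Matrix m n → Matrix m n
ferrers A i j = toℕ j <ᵇ rowSum A i

shift : ∀ {m n} → Matrix m n → Fin m → Fin n → Fin n → Matrix m n
shift A i j j' i₁ j₁ =
  if does (i₁ ≟ i)
  then (if does (j₁ ≟ j') then true else (if does (j₁ ≟ j) then false else A i₁ j₁))
  else A i₁ j₁

ValidShift : ∀ {m n} → Matrix m n → Fin m → Fin n → Fin n → Set
ValidShift A i j j' = (toℕ j' < toℕ j) × (A i j ≡ true) × (A i j' ≡ false)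
  where open import Data.Product using (_×_)

data Shifts {m n : ℕ} : ℕ → Matrix m n → Matrix m n → Set where
  done : ∀ {A B} → (∀ i j → A i j ≡ B i j) → Shifts 0 A B
  step : ∀ {k A B} (i : Fin m) (j j' : Fin n) →
         ValidShift A i j j' → Shifts k (shift A i j j') B → Shifts (suc k) A B

colDiff : ∀ {m n} → Matrix m n → Matrix m n → Fin n → ℕ
colDiff V U j = sumFin (λ i → bit (V i j) ∸ bit (U i j))

IsDisc : ∀ {m n} → Matrix m n → ℕ → Set
IsDisc A d = Shifts d A (ferrers A) × (∀ k → Shifts k A (ferrers A) → d ≤ k)
  where open import Data.Product using (_×_)

-- Count the 1s of the target F that the current matrix B fails to cover:
-- misplaced F B = Σ_j (F_j - B_j).  A shift covers at most one new position,
-- so it lowers the count by at most one, and any shift sequence from A to F has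
-- length at least misplaced F A.  Conversely, if B has the row sums of F but
-- B ≠ F, some row i has an uncovered 1 of F in a column j' and, by counting, a
-- 1 of B in a column j where F has a 0.  The rows of F are left-justified, so
-- j' < j, and shifting that 1 from j to j' lowers the count by exactly one.
-- Iterating reaches F in exactly misplaced F A shifts.
module Submission where

open import Defs
open import Data.Bool using (Bool; true; false; T)
import Data.Bool as Bool
open import Data.Empty using (⊥-elim)
open import Data.Fin using (Fin; toℕ; _≟_)
open import Data.Fin.Properties using (any?)
open import Data.Nat using (ℕ; zero; suc; _+_; _*_; _∸_; _<_; _≤_; z≤n; s≤s; z<s; _<ᵇ_)
open import Data.Nat.Properties hiding (_≟_)
open import Data.Product using (_×_; _,_; ∃; swap)
open import Function using (_∘_; case_of_)
open import Relation.Nullary using (¬_; Dec; yes; no)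
open import Relation.Nullary.Decidable using (dec-true; dec-false; _×-dec_)
open import Relation.Binary.PropositionalEquality
open import Algebra.Properties.CommutativeSemigroup +-commutativeSemigroup using (interchange)

private
  variable
    m n : ℕ

sumFin-cong : {f g : Fin n → ℕ} → (∀ k → f k ≡ g k) → sumFin f ≡ sumFin g
sumFin-cong {zero}  f≗g = refl
sumFin-cong {suc n} f≗g = cong₂ _+_ (f≗g Fin.zero) (sumFin-cong (f≗g ∘ Fin.suc))

sumFin-mono-≤ : {f g : Fin n → ℕ} → (∀ k → f k ≤ g k) → sumFin f ≤ sumFin g
sumFin-mono-≤ {zero}  f≤g = z≤n
sumFin-mono-≤ {suc n} f≤g = +-mono-≤ (f≤g Fin.zero) (sumFin-mono-≤ (f≤g ∘ Fin.suc))

sumFin-zero : {f : Fin n → ℕ} → (∀ k → f k ≡ 0) → sumFin f ≡ 0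
sumFin-zero {zero}  f≗0 = refl
sumFin-zero {suc n} f≗0 rewrite f≗0 Fin.zero = sumFin-zero (f≗0 ∘ Fin.suc)

sumFin≡0⇒≡0 : (f : Fin n → ℕ) → sumFin f ≡ 0 → ∀ k → f k ≡ 0
sumFin≡0⇒≡0 f Σf≡0 Fin.zero    = m+n≡0⇒m≡0 (f Fin.zero) Σf≡0
sumFin≡0⇒≡0 f Σf≡0 (Fin.suc k) = sumFin≡0⇒≡0 (f ∘ Fin.suc) (m+n≡0⇒n≡0 (f Fin.zero) Σf≡0) k

sumFin-positive : (f : Fin n → ℕ) → 0 < sumFin f → ∃ λ k → 0 < f k
sumFin-positive {suc n} f 0<Σf with f Fin.zero in f₀≡
... | suc _ = Fin.zero , subst (0 <_) (sym f₀≡) (s≤s z≤n)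
... | zero with sumFin-positive (f ∘ Fin.suc) 0<Σf
...   | k , 0<fk = Fin.suc k , 0<fk

sumFin-+ : (f g : Fin n → ℕ) → sumFin (λ k → f k + g k) ≡ sumFin f + sumFin g
sumFin-+ {zero}  f g = refl
sumFin-+ {suc n} f g = begin
  (f Fin.zero + g Fin.zero) + sumFin (λ k → f (Fin.suc k) + g (Fin.suc k))
    ≡⟨ cong (f Fin.zero + g Fin.zero +_) (sumFin-+ (f ∘ Fin.suc) (g ∘ Fin.suc)) ⟩
  (f Fin.zero + g Fin.zero) + (sumFin (f ∘ Fin.suc) + sumFin (g ∘ Fin.suc))
    ≡⟨ interchange (f Fin.zero) (g Fin.zero) _ _ ⟩
  sumFin f + sumFin g ∎
  where open ≡-Reasoning

sumFin-*ˡ : (c : ℕ) (f : Fin n → ℕ) → sumFin (λ k → c * f k) ≡ c * sumFin f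
sumFin-*ˡ {zero}  c f = sym (*-zeroʳ c)
sumFin-*ˡ {suc n} c f = begin
  c * f Fin.zero + sumFin (λ k → c * f (Fin.suc k))
    ≡⟨ cong (c * f Fin.zero +_) (sumFin-*ˡ c (f ∘ Fin.suc)) ⟩
  c * f Fin.zero + c * sumFin (f ∘ Fin.suc)
    ≡⟨ *-distribˡ-+ c (f Fin.zero) _ ⟨
  c * sumFin f ∎
  where open ≡-Reasoning

≤∧sumFin≡⇒≡ : {f g : Fin n → ℕ} → (∀ k → f k ≤ g k) → sumFin f ≡ sumFin g →
              ∀ k → f k ≡ g k
≤∧sumFin≡⇒≡ {suc n} {f} {g} f≤g Σf≡Σg = λ
  { Fin.zero    → f₀≡g₀
  ; (Fin.suc k) → ≤∧sumFin≡⇒≡ (f≤g ∘ Fin.suc) (+-cancelˡ-≡ (f Fin.zero) _ _ tail-eq) k }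
  where
  g₀≤f₀ : g Fin.zero ≤ f Fin.zero
  g₀≤f₀ = +-cancelʳ-≤ _ _ _ (begin
    g Fin.zero + sumFin (g ∘ Fin.suc) ≡⟨ sym Σf≡Σg ⟩
    f Fin.zero + sumFin (f ∘ Fin.suc) ≤⟨ +-monoʳ-≤ (f Fin.zero) (sumFin-mono-≤ (f≤g ∘ Fin.suc)) ⟩
    f Fin.zero + sumFin (g ∘ Fin.suc) ∎)
    where open ≤-Reasoning
  f₀≡g₀ : f Fin.zero ≡ g Fin.zero
  f₀≡g₀ = ≤-antisym (f≤g Fin.zero) g₀≤f₀
  tail-eq : f Fin.zero + sumFin (f ∘ Fin.suc) ≡ f Fin.zero + sumFin (g ∘ Fin.suc)
  tail-eq = trans Σf≡Σg (cong (_+ sumFin (g ∘ Fin.suc)) (sym f₀≡g₀))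

δ : Fin n → Fin n → ℕ
δ Fin.zero    Fin.zero    = 1
δ Fin.zero    (Fin.suc _) = 0
δ (Fin.suc _) Fin.zero    = 0
δ (Fin.suc a) (Fin.suc b) = δ a b

δ-diag : (a : Fin n) → δ a a ≡ 1
δ-diag Fin.zero    = refl
δ-diag (Fin.suc a) = δ-diag a

δ-off : {a b : Fin n} → a ≢ b → δ a b ≡ 0
δ-off {a = Fin.zero}  {Fin.zero}  a≢b = ⊥-elim (a≢b refl)
δ-off {a = Fin.zero}  {Fin.suc _} a≢b = refl
δ-off {a = Fin.suc _} {Fin.zero}  a≢b = refl
δ-off {a = Fin.suc a} {Fin.suc b} a≢b = δ-off (a≢b ∘ cong Fin.suc)

sumFin-δ : (a : Fin n) → sumFin (δ a) ≡ 1
sumFin-δ {suc n} Fin.zero    = cong suc (sumFin-zero {n} λ _ → refl)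
sumFin-δ {suc n} (Fin.suc a) = sumFin-δ a

sumFin-+δ : (f : Fin n → ℕ) (a : Fin n) → sumFin (λ k → f k + δ a k) ≡ suc (sumFin f)
sumFin-+δ f a = begin
  sumFin (λ k → f k + δ a k) ≡⟨ sumFin-+ f (δ a) ⟩
  sumFin f + sumFin (δ a)    ≡⟨ cong (sumFin f +_) (sumFin-δ a) ⟩
  sumFin f + 1               ≡⟨ +-comm (sumFin f) 1 ⟩
  suc (sumFin f)             ∎
  where open ≡-Reasoning

sumFin²-+δ*δ : (f : Fin n → Fin m → ℕ) (a : Fin n) (b : Fin m) →
  sumFin (λ k → sumFin (λ l → f k l + δ a k * δ b l)) ≡ suc (sumFin (λ k → sumFin (f k)))
sumFin²-+δ*δ f a b = begin
  sumFin (λ k → sumFin (λ l → f k l + δ a k * δ b l))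
    ≡⟨ sumFin-cong inner ⟩
  sumFin (λ k → sumFin (f k) + δ a k)
    ≡⟨ sumFin-+δ (λ k → sumFin (f k)) a ⟩
  suc (sumFin (λ k → sumFin (f k))) ∎
  where
  open ≡-Reasoning
  inner : ∀ k → sumFin (λ l → f k l + δ a k * δ b l) ≡ sumFin (f k) + δ a k
  inner k = begin
    sumFin (λ l → f k l + δ a k * δ b l)    ≡⟨ sumFin-+ (f k) _ ⟩
    sumFin (f k) + sumFin (λ l → δ a k * δ b l)
      ≡⟨ cong (sumFin (f k) +_) (sumFin-*ˡ (δ a k) (δ b)) ⟩
    sumFin (f k) + δ a k * sumFin (δ b)     ≡⟨ cong (λ s → sumFin (f k) + δ a k * s) (sumFin-δ b) ⟩
    sumFin (f k) + δ a k * 1                ≡⟨ cong (sumFin (f k) +_) (*-identityʳ (δ a k)) ⟩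
    sumFin (f k) + δ a k                    ∎

δ*δ-off : {a a₁ : Fin n} {b b₁ : Fin m} → ¬ (a₁ ≡ a × b₁ ≡ b) → δ a a₁ * δ b b₁ ≡ 0
δ*δ-off {a = a} {a₁} {b} {b₁} off with a₁ ≟ a
... | no a₁≢a    rewrite δ-off (≢-sym a₁≢a) = refl
... | yes refl with b₁ ≟ b
...   | yes refl = ⊥-elim (off (refl , refl))
...   | no b₁≢b  rewrite δ-off (≢-sym b₁≢b) = *-zeroʳ (δ a a)

true≢false : true ≢ false
true≢false ()

ones : (Fin n → Bool) → ℕ
ones f = sumFin (λ k → bit (f k))

ones≤length : (f : Fin n → Bool) → ones f ≤ n
ones≤length {zero}  f = z≤n
ones≤length {suc n} f with f Fin.zero
... | true  = s≤s (ones≤length (f ∘ Fin.suc))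
... | false = m≤n⇒m≤1+n (ones≤length (f ∘ Fin.suc))

bit-mono : {a b : Bool} → (a ≡ true → b ≡ true) → bit a ≤ bit b
bit-mono {false} a⇒b = z≤n
bit-mono {true}  a⇒b rewrite a⇒b refl = ≤-refl

bit-injective : {a b : Bool} → bit a ≡ bit b → a ≡ b
bit-injective {false} {false} _ = refl
bit-injective {true}  {true}  _ = refl

ones-⊆∧≡⇒≡ : {f g : Fin n → Bool} → (∀ k → f k ≡ true → g k ≡ true) →
             ones f ≡ ones g → ∀ k → f k ≡ g k
ones-⊆∧≡⇒≡ f⊆g ∣f∣≡∣g∣ k = bit-injective (≤∧sumFin≡⇒≡ (bit-mono ∘ f⊆g) ∣f∣≡∣g∣ k)

ones-≡-compensate : {f g : Fin n → Bool} {a : Fin n} → ones f ≡ ones g →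
  f a ≡ true → g a ≡ false → ∃ λ b → f b ≡ false × g b ≡ true
ones-≡-compensate {f = f} {g} {a} ∣f∣≡∣g∣ fa ga
  with any? (λ b → (f b Bool.≟ false) ×-dec (g b Bool.≟ true))
... | yes found = found
... | no none = ⊥-elim (true≢false (trans (sym fa) (trans (sym (g≗f a)) ga)))
  where
  g⊆f : ∀ k → g k ≡ true → f k ≡ true
  g⊆f k gk with f k in fk
  ... | true  = refl
  ... | false = ⊥-elim (none (k , fk , gk))
  g≗f : ∀ k → g k ≡ f k
  g≗f = ones-⊆∧≡⇒≡ g⊆f (sym ∣f∣≡∣g∣)

module _ (B : Matrix m n) (i : Fin m) (j j' : Fin n) where

  shift-other-row : ∀ {i₁} k → i₁ ≢ i → shift B i j j' i₁ k ≡ B i₁ k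
  shift-other-row {i₁} k i₁≢i rewrite dec-false (i₁ ≟ i) i₁≢i = refl

  shift-target : shift B i j j' i j' ≡ true
  shift-target rewrite dec-true (i ≟ i) refl | dec-true (j' ≟ j') refl = refl

  shift-source : j ≢ j' → shift B i j j' i j ≡ false
  shift-source j≢j' rewrite dec-true (i ≟ i) refl | dec-false (j ≟ j') j≢j'
                          | dec-true (j ≟ j) refl = refl

  shift-other-col : ∀ {k} → k ≢ j' → k ≢ j → shift B i j j' i k ≡ B i k
  shift-other-col {k} k≢j' k≢j rewrite dec-true (i ≟ i) refl | dec-false (k ≟ j') k≢j'
                                     | dec-false (k ≟ j) k≢j = refl

  -- Case splits on decisions that occur inside shift go through case_of_ or a
  -- helper taking Dec arguments: `with i₁ ≟ i` would abstract them in the goal.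
  shift-⊆-off-target : ∀ {i₁ k} → ¬ (i₁ ≡ i × k ≡ j') →
                       shift B i j j' i₁ k ≡ true → B i₁ k ≡ true
  shift-⊆-off-target {i₁} {k} off = case ((i₁ ≟ i) , (k ≟ j') , (k ≟ j)) of λ
    { (no i₁≢i  , _         , _)        → subst (_≡ true) (shift-other-row k i₁≢i)
    ; (yes refl , yes refl  , _)        → ⊥-elim (off (refl , refl))
    ; (yes refl , no k≢j'   , yes refl) → λ Bik → ⊥-elim (true≢false (trans (sym Bik) (shift-source k≢j')))
    ; (yes refl , no k≢j'   , no k≢j)   → subst (_≡ true) (shift-other-col k≢j' k≢j) }

  private
    bit+-cong : ∀ {a a′ x x′} → a ≡ a′ → x ≡ x′ → bit a + x ≡ bit a′ + x′
    bit+-cong = cong₂ (λ a x → bit a + x)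

  rowSum-shift-same-row : B i j ≡ true → B i j' ≡ false →
                            rowSum (shift B i j j') i ≡ rowSum B i
  rowSum-shift-same-row Bij Bij' = suc-injective (begin
    suc (rowSum (shift B i j j') i)                   ≡⟨ sumFin-+δ _ j ⟨
    sumFin (λ k → bit (shift B i j j' i k) + δ j k)  ≡⟨ sumFin-cong moved ⟩
    sumFin (λ k → bit (B i k) + δ j' k)              ≡⟨ sumFin-+δ _ j' ⟩
    suc (rowSum B i)                                  ∎)
    where
    open ≡-Reasoning
    j≢j' : j ≢ j'
    j≢j' refl = true≢false (trans (sym Bij) Bij')
    moved′ : ∀ k → Dec (k ≡ j') → Dec (k ≡ j) →
             bit (shift B i j j' i k) + δ j k ≡ bit (B i k) + δ j' k
    moved′ k (yes refl) _ =
      trans (bit+-cong shift-target (δ-off j≢j')) (sym (bit+-cong Bij' (δ-diag k)))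
    moved′ k (no k≢j') (yes refl) =
      trans (bit+-cong (shift-source j≢j') (δ-diag k)) (sym (bit+-cong Bij (δ-off (≢-sym j≢j'))))
    moved′ k (no k≢j') (no k≢j) =
      bit+-cong (shift-other-col k≢j' k≢j) (trans (δ-off (≢-sym k≢j)) (sym (δ-off (≢-sym k≢j'))))
    moved : ∀ k → bit (shift B i j j' i k) + δ j k ≡ bit (B i k) + δ j' k
    moved k = moved′ k (k ≟ j') (k ≟ j)

  rowSum-shift : B i j ≡ true → B i j' ≡ false → ∀ i₁ → rowSum (shift B i j j') i₁ ≡ rowSum B i₁
  rowSum-shift Bij Bij' i₁ = case (i₁ ≟ i) of λ
    { (no i₁≢i) → sumFin-cong λ k → cong bit (shift-other-row k i₁≢i)
    ; (yes refl) → rowSum-shift-same-row Bij Bij' }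

gap : Matrix m n → Matrix m n → Fin m → Fin n → ℕ
gap F B i j = bit (F i j) ∸ bit (B i j)

misplaced : Matrix m n → Matrix m n → ℕ
misplaced F B = sumFin (colDiff F B)

gap≤1 : (F B : Matrix m n) (i : Fin m) (j : Fin n) → gap F B i j ≤ 1
gap≤1 F B i j = ≤-trans (m∸n≤m (bit (F i j)) (bit (B i j))) (bit-mono {b = true} λ _ → refl)

gap-antitone : (F B B′ : Matrix m n) {i : Fin m} {j : Fin n} →
               (B′ i j ≡ true → B i j ≡ true) → gap F B i j ≤ gap F B′ i j
gap-antitone F B B′ {i} {j} B′⇒B = ∸-monoʳ-≤ (bit (F i j)) (bit-mono B′⇒B)

gap-positive : (F B : Matrix m n) {i : Fin m} {j : Fin n} →
               0 < gap F B i j → F i j ≡ true × B i j ≡ false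
gap-positive F B {i} {j} 0<gap with F i j | B i j
... | true  | false = refl , refl
... | true  | true  = ⊥-elim (<-irrefl refl 0<gap)
... | false | true  = ⊥-elim (<-irrefl refl 0<gap)
... | false | false = ⊥-elim (<-irrefl refl 0<gap)

gap-zero : (F B : Matrix m n) {i : Fin m} {j : Fin n} →
           gap F B i j ≡ 0 → F i j ≡ true → B i j ≡ true
gap-zero F B {i} {j} gap≡0 Fij with F i j | B i j
... | true | true = refl
... | true | false = ⊥-elim (1+n≢0 gap≡0)

module _ (F B : Matrix m n) (i : Fin m) (j j' : Fin n) where

  gap-shift-≤ : ∀ k i₁ → gap F B i₁ k ≤ gap F (shift B i j j') i₁ k + δ j' k * δ i i₁
  gap-shift-≤ k i₁ = bump ((i₁ ≟ i) ×-dec (k ≟ j'))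
    where
    bump : Dec (i₁ ≡ i × k ≡ j') → gap F B i₁ k ≤ gap F (shift B i j j') i₁ k + δ j' k * δ i i₁
    bump (yes (refl , refl)) rewrite δ-diag k | δ-diag i₁ = ≤-trans (gap≤1 F B i₁ k) (m≤n+m 1 _)
    bump (no off) rewrite δ*δ-off (off ∘ swap) | +-identityʳ (gap F (shift B i j j') i₁ k) =
      gap-antitone F B (shift B i j j') (shift-⊆-off-target B i j j' off)

  misplaced-shift-≤ : misplaced F B ≤ suc (misplaced F (shift B i j j'))
  misplaced-shift-≤ = ≤-trans (sumFin-mono-≤ λ k → sumFin-mono-≤ (gap-shift-≤ k))
    (≤-reflexive (sumFin²-+δ*δ (λ k i₁ → gap F (shift B i j j') i₁ k) j' i))

  module _ (Fij : F i j ≡ false) (Fij' : F i j' ≡ true) (Bij' : B i j' ≡ false) where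

    gap-shift-off-target : ∀ {k i₁} → ¬ (i₁ ≡ i × k ≡ j') → gap F B i₁ k ≡ gap F (shift B i j j') i₁ k
    gap-shift-off-target {k} {i₁} off = unchanged (i₁ ≟ i) (k ≟ j)
      where
      unchanged : Dec (i₁ ≡ i) → Dec (k ≡ j) → gap F B i₁ k ≡ gap F (shift B i j j') i₁ k
      unchanged (no i₁≢i) _ = cong (λ b → bit (F i₁ k) ∸ bit b) (sym (shift-other-row B i j j' k i₁≢i))
      unchanged (yes refl) (yes refl) rewrite Fij =
        trans (0∸n≡0 (bit (B i j))) (sym (0∸n≡0 (bit (shift B i j j' i j))))
      unchanged (yes refl) (no k≢j) =
        cong (λ b → bit (F i₁ k) ∸ bit b) (sym (shift-other-col B i j j' (λ k≡j' → off (refl , k≡j')) k≢j))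

    gap-shift-≡ : ∀ k i₁ → gap F B i₁ k ≡ gap F (shift B i j j') i₁ k + δ j' k * δ i i₁
    gap-shift-≡ k i₁ = bump ((i₁ ≟ i) ×-dec (k ≟ j'))
      where
      bump : Dec (i₁ ≡ i × k ≡ j') → gap F B i₁ k ≡ gap F (shift B i j j') i₁ k + δ j' k * δ i i₁
      bump (yes (refl , refl)) rewrite δ-diag k | δ-diag i₁ | shift-target B i j k | Fij' | Bij' = refl
      bump (no off) rewrite δ*δ-off (off ∘ swap) | +-identityʳ (gap F (shift B i j j') i₁ k) =
        gap-shift-off-target off

    misplaced-shift-≡ : misplaced F B ≡ suc (misplaced F (shift B i j j'))
    misplaced-shift-≡ = trans (sumFin-cong λ k → sumFin-cong (gap-shift-≡ k))
      (sumFin²-+δ*δ (λ k i₁ → gap F (shift B i j j') i₁ k) j' i)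

misplaced-positive : (F B : Matrix m n) → 0 < misplaced F B →
                     ∃ λ i → ∃ λ j → F i j ≡ true × B i j ≡ false
misplaced-positive F B 0<mis =
  let (j , 0<col) = sumFin-positive (colDiff F B) 0<mis
      (i , 0<gap) = sumFin-positive (λ i → gap F B i j) 0<col
  in i , j , gap-positive F B 0<gap

misplaced-lower-bound : ∀ {k} {F B : Matrix m n} → Shifts k B F → misplaced F B ≤ k
misplaced-lower-bound {F = F} {B} (done B≗F) = ≤-reflexive (sumFin-zero λ j → sumFin-zero λ i →
  trans (cong (λ b → bit (F i j) ∸ bit b) (B≗F i j)) (n∸n≡0 (bit (F i j))))
misplaced-lower-bound {F = F} {B} (step i j j' _ shifts) =
  ≤-trans (misplaced-shift-≤ F B i j j') (s≤s (misplaced-lower-bound shifts))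

LeftJustified : Matrix m n → Set
LeftJustified F = ∀ i a b → F i a ≡ true → F i b ≡ false → toℕ a < toℕ b

misplaced-shifts : ∀ {k} {F B : Matrix m n} → LeftJustified F →
  (∀ i → rowSum B i ≡ rowSum F i) → misplaced F B ≡ k → Shifts k B F
misplaced-shifts {k = zero} {F} {B} _ rows mis≡0 = done λ i j → sym
  (ones-⊆∧≡⇒≡ (λ j' → gap-zero F B (sumFin≡0⇒≡0 _ (sumFin≡0⇒≡0 _ mis≡0 j') i)) (sym (rows i)) j)
misplaced-shifts {k = suc k} {F} {B} justified rows mis≡ =
  let (i , j' , Fij' , Bij') = misplaced-positive F B (subst (0 <_) (sym mis≡) z<s)
      (j , Fij , Bij)        = ones-≡-compensate (sym (rows i)) Fij' Bij'
  in step i j j' (justified i j' j Fij' Fij , Bij , Bij')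
       (misplaced-shifts justified (λ i₁ → trans (rowSum-shift B i j j' Bij Bij' i₁) (rows i₁))
         (suc-injective (trans (sym (misplaced-shift-≡ F B i j j' Fij Fij' Bij')) mis≡)))

ones-<ᵇ : ∀ n r → r ≤ n → ones {n} (λ j → toℕ j <ᵇ r) ≡ r
ones-<ᵇ zero    zero    z≤n     = refl
ones-<ᵇ (suc n) zero    z≤n     = sumFin-zero {n} λ _ → refl
ones-<ᵇ (suc n) (suc r) (s≤s r≤n) = cong suc (ones-<ᵇ n r r≤n)

rowSum-ferrers : (A : Matrix m n) (i : Fin m) → rowSum (ferrers A) i ≡ rowSum A i
rowSum-ferrers {n = n} A i = ones-<ᵇ n (rowSum A i) (ones≤length (A i))

ferrers-leftJustified : (A : Matrix m n) → LeftJustified (ferrers A)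
ferrers-leftJustified A i a b Fa Fb =
  <-≤-trans (<ᵇ⇒< (toℕ a) (rowSum A i) (subst T (sym Fa) _))
            (≮⇒≥ (λ b<r → subst T Fb (<⇒<ᵇ b<r)))

proposition1 : (m n : ℕ) (A : Matrix m n) →
    NonIncreasing (rowSum A) → NonIncreasing (colSum A) →
    IsDisc A (sumFin (λ j → colDiff (ferrers A) A j))
proposition1 m n A _ _ =
  misplaced-shifts (ferrers-leftJustified A) (λ i → sym (rowSum-ferrers A i)) refl ,
  λ k → misplaced-lower-bound
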